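{- Let $G=(V,E)$ be a permutation graph, let $\{x,y\}$ be an extremal pair, let $\Delta(x)=N(C_x(y))$ and $A(x)=V\setminus(C_x(y)\cup\Delta(x))$, and let $Q$ be a minimum monophonic set of $G$. If $Q\cap A(x)=\emptyset$ then $Q\cap\Delta(x)\neq\emptyset$.
   Context: A permutation graph is a graph whose vertices correspond to $n$ line segments joining points labeled $1,\dots,n$ on a horizontal top line to the equally labeled points on a parallel bottom line, two vertices being adjacent iff their segments intersect. For nonadjacent $x,y$, $C_x(y)$ is the component of $G-N[x]$ containing $y$; $z$ is between $x$ and $y$ if $z\in C_x(y)\cap C_y(x)$; a nonadjacent pair $\{x,y\}$ is extremal if the number of vertices between them is maximum. For $C\subseteq V$, $N(C)$ is the set of vertices outside $C$ with a neighbor in $C$. For $S\subseteq V$, $J(S)$ is the set of vertices lying on a chordless $u,v$-path for some $u,v\in S$; $S$ is monophonic if $J(S)=V$, and a minimum monophonic set is one of minimum cardinality. -}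

module Defs where

open import Data.Nat using (ℕ; zero; suc; _≤_)
open import Data.Fin using (Fin; zero; suc; toℕ; fromℕ; _<_)
open import Data.Fin.Permutation using (Permutation′; _⟨$⟩ʳ_)
open import Data.Fin.Subset using (Subset; ∣_∣) renaming (_∈_ to _∈ₛ_)
open import Data.Product using (Σ; ∃; ∃-syntax; _×_; _,_)
open import Data.Sum using (_⊎_)
open import Relation.Nullary using (¬_)
open import Relation.Binary.PropositionalEquality using (_≡_; _≢_)
open import Function.Bundles using (_⇔_)
open import Function.Definitions using (Injective)

-- Segment with label i joins top position i to bottom position π(i)
-- (WLOG the top line lists the labels in order 0,…,n-1).
-- Two segments cross iff their relative order on the two lines differs.

PermAdj : ∀ {n} → Permutation′ n → Fin n → Fin n → Set
PermAdj π u v = (u < v × (π ⟨$⟩ʳ v) < (π ⟨$⟩ʳ u))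
              ⊎ (v < u × (π ⟨$⟩ʳ u) < (π ⟨$⟩ʳ v))

module Graph {n : ℕ} (Adj : Fin n → Fin n → Set) where

  V : Set
  V = Fin n

  ClosedNbh : V → V → Set
  ClosedNbh x v = v ≡ x ⊎ Adj x v

  data Reach (P : V → Set) (u : V) : V → Set where
    here : P u → Reach P u u
    step : ∀ {w v} → Reach P u w → Adj w v → P v → Reach P u v

  Comp : V → V → V → Set
  Comp x y z = Reach (λ v → ¬ ClosedNbh x v) y z

  NonAdjPair : V → V → Set
  NonAdjPair x y = x ≢ y × ¬ Adj x y

  Between : V → V → V → Set
  Between x y z = Comp x y z × Comp y x z

  HasSize : (V → Set) → ℕ → Set
  HasSize P k = Σ (Subset n) λ S → (∀ z → (z ∈ₛ S) ⇔ P z) × ∣ S ∣ ≡ k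

  Extremal : V → V → Set
  Extremal x y = NonAdjPair x y ×
    (∀ x′ y′ k k′ → NonAdjPair x′ y′ →
       HasSize (Between x y) k → HasSize (Between x′ y′) k′ → k′ ≤ k)

  NbhOf : (V → Set) → V → Set
  NbhOf C v = ¬ C v × ∃[ w ] (C w × Adj w v)

  Delta : V → V → V → Set
  Delta x y = NbhOf (Comp x y)

  Aset : V → V → V → Set
  Aset x y v = ¬ Comp x y v × ¬ Delta x y v

  OnChordlessPath : V → V → V → Set
  OnChordlessPath u v z =
    Σ ℕ λ k → Σ (Fin (suc k) → V) λ p →
      p zero ≡ u × p (fromℕ k) ≡ v × Injective _≡_ _≡_ p ×
      (∀ i j → toℕ i Data.Nat.< toℕ j → (Adj (p i) (p j) ⇔ suc (toℕ i) ≡ toℕ j)) ×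
      ∃[ i ] p i ≡ z

  J : Subset n → V → Set
  J S z = ∃[ u ] ∃[ v ] (u ∈ₛ S × v ∈ₛ S × OnChordlessPath u v z)

  Monophonic : Subset n → Set
  Monophonic S = ∀ z → J S z

  MinimumMonophonic : Subset n → Set
  MinimumMonophonic Q = Monophonic Q × (∀ S → Monophonic S → ∣ Q ∣ ≤ ∣ S ∣)

-- Segments of a permutation diagram not crossing the segment x lie entirely to its left or
-- entirely to its right, and crossing segments outside N[x] lie on the same side, so a component
-- of G - N[x] lies on one side of x. A chordless path through x meets N[x] only in the two
-- path-neighbours a, b of x; if it started and ended in C_x(y), the vertices s and w at distance two
-- from x on the path would lie on the same side of x, and the induced detour s - a - x - b - w
-- cannot be drawn with s and w on the same side. Hence x ∉ J(Q) whenever Q ⊆ C_x(y), so a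
-- monophonic set avoiding A(x) must meet Δ(x).
module Submission where

open import Defs
open import Data.Nat using (ℕ; zero; suc; _≤_; _<_; _≤′_; ≤′-reflexive; ≤′-step; z≤n; s≤s; _≤?_; _<?_)
open import Data.Nat.Properties
  using (<-trans; <-asym; <-cmp; ≤-refl; ≤-trans; <-≤-trans; <⇒≤; <⇒≢; n≤1+n; n<1+n; m≤n⇒m≤1+n; m≤n⇒m<n∨m≡n; ≤⇒≤′; ≤′⇒≤)
open import Data.Nat.Induction using (<-wellFounded)
open import Data.Fin using (Fin; zero; suc; toℕ; fromℕ; fromℕ<)
open import Data.Fin.Properties using (any?; toℕ-injective; toℕ-fromℕ<; toℕ-fromℕ; toℕ≤pred[n]) renaming (_≟_ to _≟ᶠ_)
open import Data.Fin.Permutation using (Permutation′; _⟨$⟩ʳ_; _⟨$⟩ˡ_; inverseˡ)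
open import Data.Fin.Subset using (Subset; _∈_; ⊤; _-_; ∣_∣)
open import Data.Fin.Subset.Properties using (_∈?_; ∈⊤; x∈p⇒∣p-x∣<∣p∣; x∈p∧x≢y⇒x∈p-y)
open import Data.Product using (Σ; ∃-syntax; _×_; _,_; proj₁)
open import Data.Sum using (_⊎_; inj₁; inj₂)
open import Data.Empty using (⊥; ⊥-elim)
open import Function using (flip; _∘_)
open import Function.Bundles using (_⇔_; Equivalence)
open import Induction.WellFounded using (Acc; acc)
open import Level using (0ℓ)
open import Relation.Binary using (Rel; Transitive; Asymmetric; Symmetric; tri<; tri≈; tri>)
  renaming (Decidable to Decidable₂)
open import Relation.Binary.PropositionalEquality using (_≡_; _≢_; refl; sym; trans; cong; subst; subst₂)
open import Relation.Nullary using (¬_; Dec; yes; no)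
open import Relation.Nullary.Decidable using (_×-dec_; _⊎-dec_; ¬?; decidable-stable)
open import Relation.Unary using (Pred; Decidable)

module Walks {n : ℕ} (Adj : Fin n → Fin n → Set) where
  open Graph Adj

  private variable
    P Q : Pred (Fin n) 0ℓ
    u v w : Fin n

  reach-source : Reach P u v → P u
  reach-source (here pu) = pu
  reach-source (step r _ _) = reach-source r

  reach-target : Reach P u v → P v
  reach-target (here pv) = pv
  reach-target (step _ _ pv) = pv

  reach-map : (∀ {z} → P z → Q z) → Reach P u v → Reach Q u v
  reach-map f (here pu) = here (f pu)
  reach-map f (step r a pv) = step (reach-map f r) a (f pv)

  reach-cons : P u → Adj u w → Reach P w v → Reach P u v
  reach-cons pu a (here pw) = step (here pu) a pw
  reach-cons pu a (step r b pv) = step (reach-cons pu a r) b pv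

  -- Split the walk at its last visit to u.
  reach-uncons : u ≢ v → Reach P u v → ∃[ w ] (Adj u w × Reach (λ z → P z × z ≢ u) w v)
  reach-uncons u≢v (here _) = ⊥-elim (u≢v refl)
  reach-uncons {u = u} u≢v (step {w = w} {v = v} r a pv) with w ≟ᶠ u
  ... | yes refl = v , a , here (pv , u≢v ∘ sym)
  ... | no w≢u with reach-uncons (w≢u ∘ sym) r
  ...   | w′ , a′ , r′ = w′ , a′ , step r′ a (pv , u≢v ∘ sym)

  -- Recursion on the number of allowed vertices: a walk from u to v ≢ u is an edge u w followed
  -- by a walk from w avoiding u.
  reach? : Decidable₂ Adj → Decidable P → ∀ u v → Dec (Reach P u v)
  reach? adj? P? = reachWithin ⊤ (<-wellFounded _) P? (λ _ → ∈⊤)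
    where
    reachWithin : (S : Subset n) → Acc _<_ ∣ S ∣ → {P : Pred (Fin n) 0ℓ} → Decidable P →
                  (∀ {z} → P z → z ∈ S) → ∀ u v → Dec (Reach P u v)
    reachWithin S (acc smaller) {P} P? P⊆S u v with P? u | u ≟ᶠ v
    ... | no ¬pu | _ = no (¬pu ∘ reach-source)
    ... | yes pu | yes refl = yes (here pu)
    ... | yes pu | no u≢v with any? (λ w → adj? u w ×-dec reachWithin (S - u)
                                  (smaller (x∈p⇒∣p-x∣<∣p∣ (P⊆S pu)))
                                  (λ z → P? z ×-dec ¬? (z ≟ᶠ u))
                                  (λ (pz , z≢u) → x∈p∧x≢y⇒x∈p-y (P⊆S pz) z≢u) w v)
    ...   | yes (w , a , r) = yes (reach-cons pu a (reach-map proj₁ r))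
    ...   | no ¬first-step = no (¬first-step ∘ reach-uncons u≢v)

module InducedPaths {n : ℕ} (Adj : Fin n → Fin n → Set) where
  open Graph Adj
  open Walks Adj

  -- The vertices beyond index k carry no information.
  record InducedPath (k : ℕ) : Set where
    field
      vertex      : ℕ → V
      distinct    : ∀ {i j} → i < j → j ≤ k → vertex i ≢ vertex j
      adjacent    : ∀ {i} → suc i ≤ k → Adj (vertex i) (vertex (suc i))
      nonadjacent : ∀ {i j} → suc (suc i) ≤ j → j ≤ k → ¬ Adj (vertex i) (vertex j)

    segment-reach : ∀ {P : Pred V 0ℓ} {lo hi} → lo ≤ hi → hi ≤ k →
                    (∀ j → lo ≤ j → j ≤ hi → P (vertex j)) → Reach P (vertex lo) (vertex hi)
    segment-reach lo≤hi = go (≤⇒≤′ lo≤hi)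
      where
      go : ∀ {P : Pred V 0ℓ} {lo hi} → lo ≤′ hi → hi ≤ k →
           (∀ j → lo ≤ j → j ≤ hi → P (vertex j)) → Reach P (vertex lo) (vertex hi)
      go {lo = lo} (≤′-reflexive refl) _ inP = here (inP lo ≤-refl ≤-refl)
      go (≤′-step lo≤′hi) hi<k inP =
        step (go lo≤′hi (<⇒≤ hi<k) (λ j lo≤j j≤hi → inP j lo≤j (m≤n⇒m≤1+n j≤hi)))
             (adjacent hi<k)
             (inP _ (≤′⇒≤ (≤′-step lo≤′hi)) ≤-refl)

    far-from-centre : Symmetric Adj → ∀ {m j c} → vertex m ≡ c → m ≤ k → j ≤ k →
                      suc (suc j) ≤ m ⊎ suc (suc m) ≤ j → ¬ ClosedNbh c (vertex j)
    far-from-centre _ vm≡c m≤k _ (inj₁ 2+j≤m) (inj₁ vj≡c) = distinct (<⇒≤ 2+j≤m) m≤k (trans vj≡c (sym vm≡c))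
    far-from-centre _ vm≡c _ j≤k (inj₂ 2+m≤j) (inj₁ vj≡c) = distinct (<⇒≤ 2+m≤j) j≤k (trans vm≡c (sym vj≡c))
    far-from-centre adj-sym vm≡c m≤k _ (inj₁ 2+j≤m) (inj₂ c~vj) =
      nonadjacent 2+j≤m m≤k (adj-sym (subst (λ z → Adj z _) (sym vm≡c) c~vj))
    far-from-centre _ vm≡c _ j≤k (inj₂ 2+m≤j) (inj₂ c~vj) =
      nonadjacent 2+m≤j j≤k (subst (λ z → Adj z _) (sym vm≡c) c~vj)

  open InducedPath public

  onChordlessPath⇒inducedPath : ∀ {u v z} → OnChordlessPath u v z →
    ∃[ k ] Σ (InducedPath k) λ p →
      vertex p 0 ≡ u × vertex p k ≡ v × ∃[ m ] (m ≤ k × vertex p m ≡ z)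
  onChordlessPath⇒inducedPath (k , p , p₀≡u , pₖ≡v , p-injective , chord⇔ , i , pᵢ≡z) =
    k , path , clamp-agrees zero refl p₀≡u , clamp-agrees (fromℕ k) (toℕ-fromℕ k) pₖ≡v ,
    toℕ i , toℕ≤pred[n] i , clamp-agrees i refl pᵢ≡z
    where
    clamp : ℕ → Fin (suc k)
    clamp j with j ≤? k
    ... | yes j≤k = fromℕ< (s≤s j≤k)
    ... | no _ = zero

    toℕ-clamp : ∀ {j} → j ≤ k → toℕ (clamp j) ≡ j
    toℕ-clamp {j} j≤k with j ≤? k
    ... | yes j≤k′ = toℕ-fromℕ< (s≤s j≤k′)
    ... | no j≰k = ⊥-elim (j≰k j≤k)

    chord⇔′ : ∀ {i j} → i < j → j ≤ k → Adj (p (clamp i)) (p (clamp j)) ⇔ (suc i ≡ j)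
    chord⇔′ {i} {j} i<j j≤k =
      subst₂ (λ a b → a < b → Adj (p (clamp i)) (p (clamp j)) ⇔ (suc a ≡ b))
             (toℕ-clamp (<⇒≤ (<-≤-trans i<j j≤k))) (toℕ-clamp j≤k) (chord⇔ (clamp i) (clamp j)) i<j

    path : InducedPath k
    path = record
      { vertex      = p ∘ clamp
      ; distinct    = λ i<j j≤k e → <⇒≢ i<j (clamp-injective i<j j≤k (p-injective e))
      ; adjacent    = λ {i} i<k → Equivalence.from (chord⇔′ (n<1+n i) i<k) refl
      ; nonadjacent = λ 2+i≤j j≤k a → <⇒≢ 2+i≤j (Equivalence.to (chord⇔′ (<⇒≤ 2+i≤j) j≤k) a)
      }
      where
      clamp-injective : ∀ {i j} → i < j → j ≤ k → clamp i ≡ clamp j → i ≡ j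
      clamp-injective i<j j≤k e =
        trans (sym (toℕ-clamp (<⇒≤ (<-≤-trans i<j j≤k)))) (trans (cong toℕ e) (toℕ-clamp j≤k))

    clamp-agrees : ∀ (i : Fin (suc k)) {j w} → toℕ i ≡ j → p i ≡ w → p (clamp j) ≡ w
    clamp-agrees i refl pᵢ≡w = trans (cong p (toℕ-injective (toℕ-clamp (toℕ≤pred[n] i)))) pᵢ≡w

module Dominance {A : Set} {_<_ : Rel A 0ℓ} (<-trans : Transitive _<_) (<-asym : Asymmetric _<_) where

  Point : Set
  Point = A × A

  Crossing : Point → Point → Set
  Crossing (p₁ , p₂) (q₁ , q₂) = (p₁ < q₁ × q₂ < p₂) ⊎ (q₁ < p₁ × p₂ < q₂)

  _≺_ : Point → Point → Set
  (p₁ , p₂) ≺ (q₁ , q₂) = p₁ < q₁ × p₂ < q₂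

  crossing-transfer : ∀ {x a b w} → Crossing x a → Crossing x b → a ≺ b → w ≺ x →
                      Crossing w b → Crossing w a
  crossing-transfer (inj₂ (_ , x₂<a₂)) (inj₁ (_ , b₂<x₂)) (_ , a₂<b₂) _ _ =
    ⊥-elim (<-asym a₂<b₂ (<-trans b₂<x₂ x₂<a₂))
  crossing-transfer (inj₁ (x₁<a₁ , _)) (inj₂ (b₁<x₁ , _)) (a₁<b₁ , _) _ _ =
    ⊥-elim (<-asym a₁<b₁ (<-trans b₁<x₁ x₁<a₁))
  crossing-transfer (inj₂ (_ , x₂<a₂)) (inj₂ (_ , x₂<b₂)) _ (_ , w₂<x₂) (inj₁ (_ , b₂<w₂)) =
    ⊥-elim (<-asym b₂<w₂ (<-trans w₂<x₂ x₂<b₂))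
  crossing-transfer (inj₂ (a₁<x₁ , x₂<a₂)) (inj₂ _) (a₁<b₁ , _) (_ , w₂<x₂) (inj₂ (b₁<w₁ , _)) =
    inj₂ (<-trans a₁<b₁ b₁<w₁ , <-trans w₂<x₂ x₂<a₂)
  crossing-transfer (inj₁ _) (inj₁ (x₁<b₁ , _)) _ (w₁<x₁ , _) (inj₂ (b₁<w₁ , _)) =
    ⊥-elim (<-asym b₁<w₁ (<-trans w₁<x₁ x₁<b₁))
  crossing-transfer (inj₁ (x₁<a₁ , _)) (inj₁ _) (_ , a₂<b₂) (w₁<x₁ , _) (inj₁ (_ , b₂<w₂)) =
    inj₁ (<-trans w₁<x₁ x₁<a₁ , <-trans a₂<b₂ b₂<w₂)

module Plane {A : Set} {_<_ : Rel A 0ℓ} (<-trans : Transitive _<_) (<-asym : Asymmetric _<_) where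
  open Dominance {_<_ = _<_} <-trans <-asym public
  -- Reversing the order turns Crossing p q into Crossing q p and p ≺ q into q ≺ p.
  private module Reversed = Dominance {_<_ = flip _<_} (λ q<p r<q → <-trans r<q q<p) <-asym

  crossing-sym : ∀ {p q} → Crossing p q → Crossing q p
  crossing-sym (inj₁ c) = inj₂ c
  crossing-sym (inj₂ c) = inj₁ c

  ≺∧≺⇒¬crossing : ∀ {p x q} → p ≺ x → x ≺ q → ¬ Crossing p q
  ≺∧≺⇒¬crossing (_ , p₂<x₂) (_ , x₂<q₂) (inj₁ (_ , q₂<p₂)) = <-asym q₂<p₂ (<-trans p₂<x₂ x₂<q₂)
  ≺∧≺⇒¬crossing (p₁<x₁ , _) (x₁<q₁ , _) (inj₂ (q₁<p₁ , _)) = <-asym q₁<p₁ (<-trans p₁<x₁ x₁<q₁)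

  Side : Point → Point → Set
  Side x p = p ≺ x ⊎ x ≺ p

  SameSide : Point → Point → Point → Set
  SameSide x p q = (p ≺ x × q ≺ x) ⊎ (x ≺ p × x ≺ q)

  sameSide-refl : ∀ {x p} → Side x p → SameSide x p p
  sameSide-refl (inj₁ p≺x) = inj₁ (p≺x , p≺x)
  sameSide-refl (inj₂ x≺p) = inj₂ (x≺p , x≺p)

  sameSide-sym : ∀ {x p q} → SameSide x p q → SameSide x q p
  sameSide-sym (inj₁ (p≺x , q≺x)) = inj₁ (q≺x , p≺x)
  sameSide-sym (inj₂ (x≺p , x≺q)) = inj₂ (x≺q , x≺p)

  sameSide-trans : ∀ {x p q r} → SameSide x p q → SameSide x q r → SameSide x p r
  sameSide-trans (inj₁ (p≺x , _)) (inj₁ (_ , r≺x)) = inj₁ (p≺x , r≺x)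
  sameSide-trans (inj₂ (x≺p , _)) (inj₂ (_ , x≺r)) = inj₂ (x≺p , x≺r)
  sameSide-trans (inj₁ (_ , (q₁<x₁ , _))) (inj₂ ((x₁<q₁ , _) , _)) = ⊥-elim (<-asym q₁<x₁ x₁<q₁)
  sameSide-trans (inj₂ (_ , (x₁<q₁ , _))) (inj₁ ((q₁<x₁ , _) , _)) = ⊥-elim (<-asym q₁<x₁ x₁<q₁)

  crossing⇒sameSide : ∀ {x p q} → Side x p → Side x q → Crossing p q → SameSide x p q
  crossing⇒sameSide (inj₁ p≺x) (inj₁ q≺x) _ = inj₁ (p≺x , q≺x)
  crossing⇒sameSide (inj₂ x≺p) (inj₂ x≺q) _ = inj₂ (x≺p , x≺q)
  crossing⇒sameSide (inj₁ p≺x) (inj₂ x≺q) c = ⊥-elim (≺∧≺⇒¬crossing p≺x x≺q c)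
  crossing⇒sameSide (inj₂ x≺p) (inj₁ q≺x) c = ⊥-elim (≺∧≺⇒¬crossing q≺x x≺p (crossing-sym c))

  -- s - a - x - b - w with the chords a b, s b, w a missing (s w may be an edge).
  inducedDetour-¬sameSide : ∀ {x a b s w} → Crossing x a → Crossing x b → a ≺ b ⊎ b ≺ a →
    Crossing s a → ¬ Crossing s b → Crossing w b → ¬ Crossing w a → ¬ SameSide x s w
  inducedDetour-¬sameSide xa xb (inj₁ a≺b) sa s≁b wb w≁a (inj₁ (_ , w≺x)) =
    w≁a (crossing-transfer xa xb a≺b w≺x wb)
  inducedDetour-¬sameSide xa xb (inj₂ b≺a) sa s≁b wb w≁a (inj₁ (s≺x , _)) =
    s≁b (crossing-transfer xb xa b≺a s≺x sa)
  inducedDetour-¬sameSide xa xb (inj₁ a≺b) sa s≁b wb w≁a (inj₂ (x≺s , _)) =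
    s≁b (crossing-sym (Reversed.crossing-transfer (crossing-sym xb) (crossing-sym xa) a≺b x≺s (crossing-sym sa)))
  inducedDetour-¬sameSide xa xb (inj₂ b≺a) sa s≁b wb w≁a (inj₂ (_ , x≺w)) =
    w≁a (crossing-sym (Reversed.crossing-transfer (crossing-sym xa) (crossing-sym xb) b≺a x≺w (crossing-sym wb)))

module PermutationGraph {n : ℕ} (π : Permutation′ n) where
  open Graph (PermAdj π)
  open Walks (PermAdj π)
  open InducedPaths (PermAdj π)
  open Plane {_<_ = _<_} <-trans <-asym

  -- PermAdj π u v unfolds to Crossing (point u) (point v).
  point : V → Point
  point v = toℕ v , toℕ (π ⟨$⟩ʳ v)

  adj-sym : Symmetric (PermAdj π)
  adj-sym = crossing-sym

  adj? : Decidable₂ (PermAdj π)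
  adj? u v = ((toℕ u <? toℕ v) ×-dec (toℕ (π ⟨$⟩ʳ v) <? toℕ (π ⟨$⟩ʳ u)))
       ⊎-dec ((toℕ v <? toℕ u) ×-dec (toℕ (π ⟨$⟩ʳ u) <? toℕ (π ⟨$⟩ʳ v)))

  π-injective : ∀ {u v} → toℕ (π ⟨$⟩ʳ u) ≡ toℕ (π ⟨$⟩ʳ v) → u ≡ v
  π-injective e = trans (sym (inverseˡ π)) (trans (cong (π ⟨$⟩ˡ_) (toℕ-injective e)) (inverseˡ π))

  nonadjacent⇒comparable : ∀ {u v} → u ≢ v → ¬ PermAdj π u v → point u ≺ point v ⊎ point v ≺ point u
  nonadjacent⇒comparable {u} {v} u≢v u≁v with <-cmp (toℕ u) (toℕ v) | <-cmp (toℕ (π ⟨$⟩ʳ u)) (toℕ (π ⟨$⟩ʳ v))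
  ... | tri≈ _ e _ | _          = ⊥-elim (u≢v (toℕ-injective e))
  ... | _          | tri≈ _ e _ = ⊥-elim (u≢v (π-injective e))
  ... | tri< a _ _ | tri< b _ _ = inj₁ (a , b)
  ... | tri< a _ _ | tri> _ _ b = ⊥-elim (u≁v (inj₁ (a , b)))
  ... | tri> _ _ a | tri< b _ _ = ⊥-elim (u≁v (inj₂ (a , b)))
  ... | tri> _ _ a | tri> _ _ b = inj₂ (a , b)

  module _ (x : V) where

    Outside : Pred V 0ℓ
    Outside z = ¬ ClosedNbh x z

    outside? : Decidable Outside
    outside? z = ¬? ((z ≟ᶠ x) ⊎-dec adj? x z)

    side : ∀ {z} → Outside z → Side (point x) (point z)
    side z∉N = nonadjacent⇒comparable (z∉N ∘ inj₁) (z∉N ∘ inj₂ ∘ adj-sym)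

    reach-sameSide : ∀ {u v} → Reach Outside u v → SameSide (point x) (point u) (point v)
    reach-sameSide (here u∉N) = sameSide-refl (side u∉N)
    reach-sameSide (step r u~v v∉N) =
      sameSide-trans (reach-sameSide r) (crossing⇒sameSide (side (reach-target r)) (side v∉N) u~v)

    module _ {k : ℕ} (p : InducedPath k) where
      private
        q : ℕ → V
        q = vertex p

      inducedPath-¬throughInterior : ∀ {m′} → suc (suc (suc (suc m′))) ≤ k → q (suc (suc m′)) ≡ x →
        SameSide (point x) (point (q 0)) (point (q k)) → ⊥
      inducedPath-¬throughInterior {m′} 4+m′≤k qm≡x ends =
        inducedDetour-¬sameSide x~a x~b a⋚b s~a s≁b w~b w≁a s⋈w
        where
        3+m′≤k : suc (suc (suc m′)) ≤ k
        3+m′≤k = <⇒≤ 4+m′≤k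
        2+m′≤k : suc (suc m′) ≤ k
        2+m′≤k = <⇒≤ 3+m′≤k
        1+m′≤k : suc m′ ≤ k
        1+m′≤k = <⇒≤ 2+m′≤k
        m′≤k : m′ ≤ k
        m′≤k = <⇒≤ 1+m′≤k
        s a b w : V
        s = q m′
        a = q (suc m′)
        b = q (suc (suc (suc m′)))
        w = q (suc (suc (suc (suc m′))))
        x~a : PermAdj π x a
        x~a = adj-sym (subst (PermAdj π a) qm≡x (adjacent p 2+m′≤k))
        x~b : PermAdj π x b
        x~b = subst (λ z → PermAdj π z b) qm≡x (adjacent p 3+m′≤k)
        a⋚b : point a ≺ point b ⊎ point b ≺ point a
        a⋚b = nonadjacent⇒comparable (distinct p (n≤1+n _) 3+m′≤k) (nonadjacent p ≤-refl 3+m′≤k)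
        s~a : PermAdj π s a
        s~a = adjacent p 1+m′≤k
        s≁b : ¬ PermAdj π s b
        s≁b = nonadjacent p (n≤1+n _) 3+m′≤k
        w~b : PermAdj π w b
        w~b = adj-sym (adjacent p 4+m′≤k)
        w≁a : ¬ PermAdj π w a
        w≁a = nonadjacent p (n≤1+n _) 4+m′≤k ∘ adj-sym
        start : Reach Outside (q 0) s
        start = segment-reach p z≤n m′≤k λ j _ j≤m′ →
          far-from-centre p adj-sym qm≡x 2+m′≤k (≤-trans j≤m′ m′≤k) (inj₁ (s≤s (s≤s j≤m′)))
        end : Reach Outside w (q k)
        end = segment-reach p 4+m′≤k ≤-refl λ j 4+m′≤j j≤k →
          far-from-centre p adj-sym qm≡x 2+m′≤k j≤k (inj₂ 4+m′≤j)
        s⋈w : SameSide (point x) (point s) (point w)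
        s⋈w = sameSide-trans (sameSide-sym (reach-sameSide start))
                (sameSide-trans ends (sameSide-sym (reach-sameSide end)))

      inducedPath-¬through : ∀ {m} → Outside (q 0) → Outside (q k) →
        SameSide (point x) (point (q 0)) (point (q k)) → m ≤ k → q m ≢ x
      inducedPath-¬through {zero} q₀∉N _ _ _ q₀≡x = q₀∉N (inj₁ q₀≡x)
      inducedPath-¬through {suc zero} q₀∉N _ _ 1≤k q₁≡x =
        q₀∉N (inj₂ (adj-sym (subst (PermAdj π (q 0)) q₁≡x (adjacent p 1≤k))))
      inducedPath-¬through {suc (suc m′)} _ qₖ∉N ends m≤k qm≡x with m≤n⇒m<n∨m≡n m≤k
      ... | inj₂ m≡k = qₖ∉N (inj₁ (subst (λ j → q j ≡ x) m≡k qm≡x))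
      ... | inj₁ m<k with m≤n⇒m<n∨m≡n m<k
      ...   | inj₂ 1+m≡k = qₖ∉N (inj₂ (subst₂ (PermAdj π) qm≡x (cong q 1+m≡k) (adjacent p m<k)))
      ...   | inj₁ 2+m<k = inducedPath-¬throughInterior 2+m<k qm≡x ends

  module _ (x y : V) where

    comp? : Decidable (Comp x y)
    comp? = reach? adj? (outside? x) y

    delta? : Decidable (Delta x y)
    delta? z = ¬? (comp? z) ×-dec any? (λ w → comp? w ×-dec adj? w z)

    comp-¬chordlessThrough : ∀ {u v} → Comp x y u → Comp x y v → ¬ OnChordlessPath u v x
    comp-¬chordlessThrough u∈C v∈C path with onChordlessPath⇒inducedPath path
    ... | k , p , refl , refl , m , m≤k , qm≡x =
      inducedPath-¬through x p (reach-target u∈C) (reach-target v∈C)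
        (sameSide-trans (sameSide-sym (reach-sameSide x u∈C)) (reach-sameSide x v∈C)) m≤k qm≡x

mainTheorem17 : (n : ℕ) (π : Permutation′ n) (x y : Fin n) (Q : Subset n) →
    Graph.Extremal (PermAdj π) x y →
    Graph.MinimumMonophonic (PermAdj π) Q →
    (∀ v → v ∈ Q → ¬ Graph.Aset (PermAdj π) x y v) →
    ∃[ v ] (v ∈ Q × Graph.Delta (PermAdj π) x y v)
mainTheorem17 n π x y Q _ (monophonic , _) Q∩A≡∅ with any? (λ v → v ∈? Q ×-dec PermutationGraph.delta? π x y v)
... | yes Q∩Δ≢∅ = Q∩Δ≢∅
... | no Q∩Δ≡∅ = ⊥-elim (x∉J (monophonic x))
  where
  open Graph (PermAdj π)
  open PermutationGraph π

  Q⊆C : ∀ {z} → z ∈ Q → Comp x y z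
  Q⊆C {z} z∈Q = decidable-stable (comp? x y z) λ z∉C → Q∩A≡∅ z z∈Q (z∉C , λ z∈Δ → Q∩Δ≡∅ (z , z∈Q , z∈Δ))

  x∉J : ¬ J Q x
  x∉J (u , v , u∈Q , v∈Q , path) = comp-¬chordlessThrough x y (Q⊆C u∈Q) (Q⊆C v∈Q) path
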